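{- There exists an infinite family of graphs such that for each graph $G$ in the family, $D_{\Gamma(G)+1}(G)$ is not connected.
   Context: All graphs are finite, simple and undirected. A set $S\subseteq V(G)$ is a dominating set of $G$ if every vertex of $V(G)\setminus S$ is adjacent to a vertex of $S$; $\Gamma(G)$ denotes the maximum cardinality of a minimal (with respect to inclusion) dominating set of $G$. For a positive integer $k$, the $k$-dominating graph $D_k(G)$ has as vertices the dominating sets of $G$ of cardinality at most $k$, two such sets being adjacent iff their symmetric difference consists of exactly one vertex of $G$. -}

module Defs where

open import Data.Nat using (ℕ; _≤_)
open import Data.Bool using (Bool; true; false)
open import Data.Fin using (Fin)
open import Data.Fin.Subset using (Subset; _∈_; _∉_; _⊂_; ∣_∣)
open import Data.Product using (Σ; ∃; ∃-syntax; _×_; _,_)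
open import Data.Sum using (_⊎_)
open import Relation.Nullary using (¬_)
open import Relation.Binary.PropositionalEquality using (_≡_; _≢_)
open import Relation.Binary.Construct.Closure.ReflexiveTransitive using (Star)

record Graph (n : ℕ) : Set where
  field
    adj   : Fin n → Fin n → Bool
    sym   : ∀ u v → adj u v ≡ adj v u
    irrefl : ∀ v → adj v v ≡ false
open Graph public

Adj : {n : ℕ} → Graph n → Fin n → Fin n → Set
Adj G u v = adj G u v ≡ true

Dominating : {n : ℕ} → Graph n → Subset n → Set
Dominating G S = ∀ v → v ∉ S → ∃[ u ] (u ∈ S × Adj G u v)

MinimalDominating : {n : ℕ} → Graph n → Subset n → Set
MinimalDominating G S = Dominating G S × (∀ T → T ⊂ S → ¬ Dominating G T)

-- k = Γ(G): maximum cardinality of a minimal dominating set.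
IsUpperDomination : {n : ℕ} → Graph n → ℕ → Set
IsUpperDomination G k =
  (∃[ S ] (MinimalDominating G S × ∣ S ∣ ≡ k)) ×
  (∀ S → MinimalDominating G S → ∣ S ∣ ≤ k)

DkVertex : {n : ℕ} → Graph n → ℕ → Subset n → Set
DkVertex G k S = Dominating G S × ∣ S ∣ ≤ k

SymDiffOne : {n : ℕ} → Subset n → Subset n → Set
SymDiffOne {n} S T =
  ∃[ v ] ((v ∈ S × v ∉ T ⊎ v ∉ S × v ∈ T) ×
          (∀ w → w ≢ v → (w ∈ S → w ∈ T) × (w ∈ T → w ∈ S)))

DkEdge : {n : ℕ} → Graph n → ℕ → Subset n → Subset n → Set
DkEdge G k S T = DkVertex G k S × DkVertex G k T × SymDiffOne S T

DkDisconnected : {n : ℕ} → Graph n → ℕ → Set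
DkDisconnected G k =
  ∃[ S ] ∃[ T ] (DkVertex G k S × DkVertex G k T × ¬ Star (DkEdge G k) S T)

-- Let H consist of a triangle 0,1,2 whose every corner i has two further
-- neighbours {a,b} with N(a) ∩ N(b) = {i}; these six vertices form two more
-- triangles, each meeting every pair once.  The triangle is a minimal
-- dominating set and Γ(H) = 3.  In a set of at most four vertices containing
-- the triangle no corner can be dropped, since its pair would then have to
-- be dominated by the single vertex outside the triangle.  So every vertex of
-- D₄(H) reachable from the triangle contains it, and {0,3,4} is unreachable.
-- An isolated vertex lies in every dominating set, so adding one raises Γ and
-- all cardinalities by one and preserves both properties.
module Submission where

open import Defs
open import Data.Nat as ℕ using (ℕ; _≤_; suc; zero; _+_; s≤s)
open import Data.Nat.Properties using (m≤m+n; n≤1+n)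
open import Data.Bool as Bool using (Bool; true; false; _∨_)
open import Data.Bool.Properties using (∨-comm)
open import Data.Fin as Fin using (Fin; toℕ)
open import Data.Fin.Properties using (all?; any?; suc-injective)
open import Data.Fin.Subset using (Subset; _∈_; _∉_; _⊆_; ∣_∣; inside; outside; _-_)
open import Data.Fin.Subset.Properties
  using (_∈?_; _⊆?_; drop-there; anySubset?; x∈p⇒p-x⊂p; x∈p∧x≢y⇒x∈p-y)
open import Data.Product using (∃-syntax; _×_; _,_; proj₁; proj₂)
open import Data.Sum using (_⊎_; inj₁; inj₂)
open import Data.Vec using ([]; _∷_; tail; here; there)
open import Function using (id; _∘_)
open import Relation.Nullary using (¬_; Dec; yes; no; contradiction)
open import Relation.Nullary.Decidable using (_→-dec_; _×-dec_; ¬?; from-yes; from-no)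
open import Relation.Binary.PropositionalEquality using (_≡_; refl; cong)
open import Relation.Binary.Construct.Closure.ReflexiveTransitive using (Star; ε; _◅_; gmap)

Dominating? : ∀ {n} (G : Graph n) S → Dec (Dominating G S)
Dominating? G S =
  all? λ v → ¬? (v ∈? S) →-dec any? λ u → (u ∈? S) ×-dec (adj G u v Bool.≟ true)

Dominating-mono : ∀ {n} (G : Graph n) {S T} → S ⊆ T → Dominating G S → Dominating G T
Dominating-mono G S⊆T domS v v∉T with domS v (v∉T ∘ S⊆T)
... | u , u∈S , uv = u , S⊆T u∈S , uv

-- By monotonicity of domination, minimality is a local condition and hence cheap to decide.
VertexMinimal : ∀ {n} → Graph n → Subset n → Set
VertexMinimal G S = ∀ v → v ∈ S → ¬ Dominating G (S - v)

minimal⇒vertexMinimal : ∀ {n} (G : Graph n) {S} → MinimalDominating G S → VertexMinimal G S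
minimal⇒vertexMinimal G {S} (_ , minimal) v v∈S = minimal (S - v) (x∈p⇒p-x⊂p v∈S)

VertexMinimal? : ∀ {n} (G : Graph n) S → Dec (VertexMinimal G S)
VertexMinimal? G S = all? λ v → (v ∈? S) →-dec ¬? (Dominating? G (S - v))

vertexMinimal⇒minimal : ∀ {n} (G : Graph n) {S} →
                        Dominating G S → VertexMinimal G S → MinimalDominating G S
vertexMinimal⇒minimal G {S} domS vmin = domS , λ T (T⊆S , v , v∈S , v∉T) domT →
  vmin v v∈S (Dominating-mono G (λ {w} w∈T → x∈p∧x≢y⇒x∈p-y (T⊆S w∈T) (λ { refl → v∉T w∈T })) domT)

Frozen : ∀ {n} → Graph n → ℕ → Subset n → Set
Frozen G k S₀ = ∀ S → S₀ ⊆ S → ∣ S ∣ ≤ k → ∀ u → u ∈ S₀ → ¬ Dominating G (S - u)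

module _ {n} (G : Graph n) {k S₀} (frozen : Frozen G k S₀) where

  frozen-edge : ∀ {S T} → DkEdge G k S T → S₀ ⊆ S → S₀ ⊆ T
  frozen-edge (_ , _ , v , _ , same) S₀⊆S {w} w∈S₀ with w Fin.≟ v
  ... | no w≢v = proj₁ (same w w≢v) (S₀⊆S w∈S₀)
  frozen-edge (_ , _ , _ , inj₂ (_ , v∈T) , _) _ _ | yes refl = v∈T
  frozen-edge {S} {T} ((_ , ∣S∣≤k) , (domT , _) , v , inj₁ (_ , v∉T) , same) S₀⊆S w∈S₀
    | yes refl = contradiction (Dominating-mono G T⊆S-v domT) (frozen S S₀⊆S ∣S∣≤k v w∈S₀)
    where
    T⊆S-v : T ⊆ S - v
    T⊆S-v {x} x∈T with x Fin.≟ v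
    ... | yes refl = contradiction x∈T v∉T
    ... | no x≢v = x∈p∧x≢y⇒x∈p-y (proj₂ (same x x≢v) x∈T) x≢v

  frozen-path : ∀ {S T} → Star (DkEdge G k) S T → S₀ ⊆ S → S₀ ⊆ T
  frozen-path ε = id
  frozen-path (e ◅ p) = frozen-path p ∘ frozen-edge e

  frozen⇒disconnected : DkVertex G k S₀ → ∀ {T} → DkVertex G k T → ¬ S₀ ⊆ T →
                        DkDisconnected G k
  frozen⇒disconnected vS₀ {T} vT S₀⊈T = S₀ , T , vS₀ , vT , λ p → S₀⊈T (frozen-path p id)

module _ {n} (G : Graph n) where

  private
    adj⁺ : Fin (suc n) → Fin (suc n) → Bool
    adj⁺ (Fin.suc u) (Fin.suc v) = adj G u v
    adj⁺ _           _           = false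

    sym⁺ : ∀ u v → adj⁺ u v ≡ adj⁺ v u
    sym⁺ Fin.zero    Fin.zero    = refl
    sym⁺ Fin.zero    (Fin.suc v) = refl
    sym⁺ (Fin.suc u) Fin.zero    = refl
    sym⁺ (Fin.suc u) (Fin.suc v) = Graph.sym G u v

    irrefl⁺ : ∀ v → adj⁺ v v ≡ false
    irrefl⁺ Fin.zero    = refl
    irrefl⁺ (Fin.suc v) = irrefl G v

  -- The new vertex is Fin.zero, so a subset of it is (b ∷ S) with b its membership.
  addIsolated : Graph (suc n)
  addIsolated = record { adj = adj⁺ ; sym = sym⁺ ; irrefl = irrefl⁺ }

  isolated∈dominating : ∀ {b S} → Dominating addIsolated (b ∷ S) → b ≡ inside
  isolated∈dominating {inside}  _    = refl
  isolated∈dominating {outside} domS with domS Fin.zero (λ ())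
  ... | Fin.zero  , _ , ()
  ... | Fin.suc _ , _ , ()

  dominating-∷⁻ : ∀ {b S} → Dominating addIsolated (b ∷ S) → Dominating G S
  dominating-∷⁻ domS v v∉S with domS (Fin.suc v) (v∉S ∘ drop-there)
  ... | Fin.suc u , there u∈S , uv = u , u∈S , uv

  dominating-∷⁺ : ∀ {S} → Dominating G S → Dominating addIsolated (inside ∷ S)
  dominating-∷⁺ domS Fin.zero    0∉S = contradiction here 0∉S
  dominating-∷⁺ domS (Fin.suc v) v∉S with domS v (v∉S ∘ there)
  ... | u , u∈S , uv = Fin.suc u , there u∈S , uv

  minimal-∷⁺ : ∀ {S} → MinimalDominating G S → MinimalDominating addIsolated (inside ∷ S)
  minimal-∷⁺ (domS , minimal) = dominating-∷⁺ domS , λ where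
    (outside ∷ T) _ domT → contradiction (isolated∈dominating domT) λ ()
    (inside ∷ T) (_ , Fin.zero , _ , 0∉T) _ → 0∉T here
    (inside ∷ T) (T⊆S , Fin.suc x , there x∈S , x∉T) domT →
      minimal T (drop-there ∘ T⊆S ∘ there , x , x∈S , x∉T ∘ there) (dominating-∷⁻ domT)

  minimal-∷⁻ : ∀ {S} → MinimalDominating addIsolated (inside ∷ S) → MinimalDominating G S
  minimal-∷⁻ (domS , minimal) = dominating-∷⁻ domS , λ T (T⊆S , x , x∈S , x∉T) domT →
    minimal (inside ∷ T) (T⊆S⁺ T⊆S , Fin.suc x , there x∈S , x∉T ∘ drop-there) (dominating-∷⁺ domT)
    where
    T⊆S⁺ : ∀ {S T : Subset n} → T ⊆ S → inside ∷ T ⊆ inside ∷ S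
    T⊆S⁺ _   here      = here
    T⊆S⁺ T⊆S (there p) = there (T⊆S p)

  addIsolated-upperDomination : ∀ {γ} → IsUpperDomination G γ → IsUpperDomination addIsolated (suc γ)
  addIsolated-upperDomination ((S , minS , ∣S∣≡γ) , maximum) =
    (inside ∷ S , minimal-∷⁺ minS , cong suc ∣S∣≡γ) , λ where
      (outside ∷ T) (domT , _) → contradiction (isolated∈dominating domT) λ ()
      (inside ∷ T) minT → s≤s (maximum T (minimal-∷⁻ minT))

  Dk-vertex-tail : ∀ {k A} → DkVertex addIsolated (suc k) A → DkVertex G k (tail A)
  Dk-vertex-tail {A = outside ∷ _} (domA , _) = contradiction (isolated∈dominating domA) λ ()
  Dk-vertex-tail {A = inside ∷ _} (domA , s≤s ∣A∣≤k) = dominating-∷⁻ domA , ∣A∣≤k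

  -- Both endpoints contain the isolated vertex, so the differing vertex is an old one.
  Dk-edge-tail : ∀ {k A B} → DkEdge addIsolated (suc k) A B → DkEdge G k (tail A) (tail B)
  Dk-edge-tail {A = outside ∷ _} ((domA , _) , _) = contradiction (isolated∈dominating domA) λ ()
  Dk-edge-tail {B = outside ∷ _} (_ , (domB , _) , _) = contradiction (isolated∈dominating domB) λ ()
  Dk-edge-tail {A = inside ∷ _} {inside ∷ _} (_ , _ , Fin.zero , inj₁ (_ , 0∉B) , _) = contradiction here 0∉B
  Dk-edge-tail {A = inside ∷ _} {inside ∷ _} (_ , _ , Fin.zero , inj₂ (0∉A , _) , _) = contradiction here 0∉A
  Dk-edge-tail {A = inside ∷ _} {inside ∷ _} (vA , vB , Fin.suc v , diff , same) =
    Dk-vertex-tail vA , Dk-vertex-tail vB , v , diff′ diff , λ w w≢v →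
      let A⇔B = same (Fin.suc w) (w≢v ∘ suc-injective)
      in drop-there ∘ proj₁ A⇔B ∘ there , drop-there ∘ proj₂ A⇔B ∘ there
    where
    diff′ : ∀ {A B} → (Fin.suc v ∈ A × Fin.suc v ∉ B ⊎ Fin.suc v ∉ A × Fin.suc v ∈ B) →
            (v ∈ tail A × v ∉ tail B ⊎ v ∉ tail A × v ∈ tail B)
    diff′ {_ ∷ _} {_ ∷ _} (inj₁ (there v∈A , v∉B)) = inj₁ (v∈A , v∉B ∘ there)
    diff′ {_ ∷ _} {_ ∷ _} (inj₂ (v∉A , there v∈B)) = inj₂ (v∉A ∘ there , v∈B)

  addIsolated-disconnected : ∀ {k} → DkDisconnected G k → DkDisconnected addIsolated (suc k)
  addIsolated-disconnected (S , T , (domS , ∣S∣≤k) , (domT , ∣T∣≤k) , noPath) =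
    inside ∷ S , inside ∷ T , (dominating-∷⁺ domS , s≤s ∣S∣≤k) , (dominating-∷⁺ domT , s≤s ∣T∣≤k) ,
    noPath ∘ gmap tail Dk-edge-tail

edge : ℕ → ℕ → Bool
edge 0 1 = true
edge 0 2 = true
edge 1 2 = true
edge 0 3 = true
edge 0 4 = true
edge 1 5 = true
edge 1 6 = true
edge 2 7 = true
edge 2 8 = true
edge 3 5 = true
edge 3 8 = true
edge 4 6 = true
edge 4 7 = true
edge 5 8 = true
edge 6 7 = true
edge _ _ = false

H : Graph 9
H = record
  { adj    = adjH
  ; sym    = λ u v → ∨-comm (edge (toℕ u) (toℕ v)) (edge (toℕ v) (toℕ u))
  ; irrefl = from-yes (all? λ v → adjH v v Bool.≟ false)
  }
  where
  adjH : Fin 9 → Fin 9 → Bool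
  adjH u v = edge (toℕ u) (toℕ v) ∨ edge (toℕ v) (toℕ u)

triangle : Subset 9
triangle = inside ∷ inside ∷ inside ∷ outside ∷ outside ∷ outside ∷ outside ∷ outside ∷ outside ∷ []

star : Subset 9
star = inside ∷ outside ∷ outside ∷ inside ∷ inside ∷ outside ∷ outside ∷ outside ∷ outside ∷ []

triangle-dominating : Dominating H triangle
triangle-dominating = from-yes (Dominating? H triangle)

star-dominating : Dominating H star
star-dominating = from-yes (Dominating? H star)

triangle-minimal : MinimalDominating H triangle
triangle-minimal =
  vertexMinimal⇒minimal H triangle-dominating (from-yes (VertexMinimal? H triangle))

minimal-size≤3 : ∀ S → MinimalDominating H S → ∣ S ∣ ≤ 3
minimal-size≤3 S minS with ∣ S ∣ ℕ.≤? 3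
... | yes ∣S∣≤3 = ∣S∣≤3
... | no ∣S∣≰3 = contradiction (S , proj₁ minS , minimal⇒vertexMinimal H minS , ∣S∣≰3) noLarge
  where
  noLarge : ¬ (∃[ S ] (Dominating H S × VertexMinimal H S × ¬ (∣ S ∣ ≤ 3)))
  noLarge = from-no (anySubset? λ S → Dominating? H S ×-dec VertexMinimal? H S ×-dec ¬? (∣ S ∣ ℕ.≤? 3))

H-upperDomination : IsUpperDomination H 3
H-upperDomination = (triangle , triangle-minimal , refl) , minimal-size≤3

triangle-frozen : Frozen H 4 triangle
triangle-frozen S tri⊆S ∣S∣≤4 u u∈tri domS-u = noThaw (S , tri⊆S , ∣S∣≤4 , u , u∈tri , domS-u)
  where
  noThaw : ¬ (∃[ S ] (triangle ⊆ S × ∣ S ∣ ≤ 4 × ∃[ u ] (u ∈ triangle × Dominating H (S - u))))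
  noThaw = from-no (anySubset? λ S → (triangle ⊆? S) ×-dec (∣ S ∣ ℕ.≤? 4) ×-dec
                                      any? λ u → (u ∈? triangle) ×-dec Dominating? H (S - u))

H-D₄-disconnected : DkDisconnected H 4
H-D₄-disconnected =
  frozen⇒disconnected H triangle-frozen (triangle-dominating , n≤1+n 3) {star}
    (star-dominating , n≤1+n 3) (from-no (triangle ⊆? star))

H-plus-isolated : ∀ m → ∃[ G ] ∃[ γ ] (IsUpperDomination {m + 9} G γ × DkDisconnected G (suc γ))
H-plus-isolated zero = H , 3 , H-upperDomination , H-D₄-disconnected
H-plus-isolated (suc m) with H-plus-isolated m
... | G , γ , upper , disconnected =
  addIsolated G , suc γ , addIsolated-upperDomination G upper , addIsolated-disconnected G disconnected

theorem3 : ∀ (m : ℕ) → ∃[ n ] (m ≤ n × ∃[ G ] ∃[ γ ]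
    (IsUpperDomination {n} G γ × DkDisconnected G (suc γ)))
theorem3 m = m + 9 , m≤m+n m 9 , H-plus-isolated m
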